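{- Let $\ell,n$ be positive integers with $2^\ell\le n$. If $A\subseteq\mathbb{Z}_{2^n}$ has size $|A|>\left(1-\frac{1}{2^\ell-1}\right)2^n$, then there exists $x\in\mathbb{Z}_{2^n}$ such that $\{x,2x,3x,\dots,(2^\ell-1)x\}\subseteq A$.
   Context: $\mathbb{Z}_{2^n}$ is the cyclic group of integers modulo $2^n$; multiples $jx$ are taken modulo $2^n$. -}

module Defs where

open import Data.Nat using (ℕ; _*_; _^_)
open import Data.Nat.Properties using (m^n≢0)
open import Data.Nat.DivMod using (_mod_)
open import Data.Fin using (Fin; toℕ)

-- ℤ_{2^n} is represented as Fin (2 ^ n): the element k stands for the
-- residue class of k modulo 2^n.
-- The multiple j·x in ℤ_{2^n}, i.e. (j * x) mod 2^n.
mulZ : (n : ℕ) → ℕ → Fin (2 ^ n) → Fin (2 ^ n)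
mulZ n j x = _mod_ (j * toℕ x) (2 ^ n) {{m^n≢0 2 n}}

-- Write ℓ = L + 1, M = 2^ℓ - 1, and let β : ℕ → ℕ be 2^n-periodic (the
-- indicator of the complement of A), with (∑_{k<2^n} β k) · M < 2^n.  We look
-- for x with β (j x) = 0 for 1 ≤ j < 2^ℓ, by induction on n.
--   * If n ≤ L then 2^n ≤ M, so β vanishes identically and x = 0 works.
--   * If n = ℓ + s, split the residues by 2-adic valuation: the mass of β is
--     D + R, where D is carried by residues of valuation < ℓ and R by
--     multiples of 2^ℓ.  Multiplication by an odd number permutes the odd
--     residues, so a double count gives ∑_{x odd} #{j : β (j x) ≠ 0} = 2^L · D.
--     If 2^L · D < 2^(L+s), the number of odd x, some odd x is good.
--     Otherwise D ≥ 2^s, which forces R · M < 2^s: the function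
--     k ↦ β (2^ℓ k) satisfies the hypothesis modulo 2^s, and a good x for it
--     gives the good element 2^ℓ x for β.
module Submission where

open import Defs
open import Data.Nat using (ℕ; _*_; _^_; _∸_; _≤_; _<_; NonZero)
open import Data.Fin using (Fin)
open import Data.Fin.Subset using (Subset; _∈_; ∣_∣)
open import Data.Product using (∃)

open import Data.Nat using (zero; suc; _+_; z≤n; s≤s; _≤?_; _<?_)
open import Data.Nat.Properties
open import Data.Nat.DivMod using (_%_; _mod_; m%n%n≡m%n; [m+n]%n≡m%n; m<n⇒m%n≡m; %-distribˡ-*)
open import Data.Nat.Induction using (<-wellFounded)
open import Data.Nat.Tactic.RingSolver using (solve-∀)
open import Data.Fin as Fin using (toℕ)
open import Data.Fin.Properties using (toℕ-fromℕ<)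
open import Data.Fin.Subset using (inside; outside)
open import Data.Vec using ([]; _∷_; here; there)
open import Data.Product using (_,_)
open import Data.Empty using (⊥-elim)
open import Data.Sum using (_⊎_; inj₁; inj₂)
open import Induction.WellFounded using (Acc; acc)
open import Relation.Nullary using (yes; no)
open import Relation.Binary.PropositionalEquality

∑ : ℕ → (ℕ → ℕ) → ℕ
∑ zero    f = 0
∑ (suc n) f = f 0 + ∑ n (λ k → f (suc k))

∑-cong-< : ∀ n {f g : ℕ → ℕ} → (∀ k → k < n → f k ≡ g k) → ∑ n f ≡ ∑ n g
∑-cong-< zero    e = refl
∑-cong-< (suc n) e = cong₂ _+_ (e 0 (s≤s z≤n)) (∑-cong-< n (λ k k<n → e (suc k) (s≤s k<n)))

∑-cong : ∀ n {f g : ℕ → ℕ} → (∀ k → f k ≡ g k) → ∑ n f ≡ ∑ n g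
∑-cong n e = ∑-cong-< n (λ k _ → e k)

∑-++ : ∀ a b (f : ℕ → ℕ) → ∑ (a + b) f ≡ ∑ a f + ∑ b (λ k → f (a + k))
∑-++ zero    b f = refl
∑-++ (suc a) b f = trans (cong (f 0 +_) (∑-++ a b (λ k → f (suc k)))) (sym (+-assoc (f 0) _ _))

∑-+ : ∀ n (f g : ℕ → ℕ) → ∑ n (λ k → f k + g k) ≡ ∑ n f + ∑ n g
∑-+ zero    f g = refl
∑-+ (suc n) f g = trans (cong (f 0 + g 0 +_) (∑-+ n (λ k → f (suc k)) (λ k → g (suc k))))
                        (+-+-interchange (f 0) _ _ _)
  where
  +-+-interchange : ∀ a b c d → a + b + (c + d) ≡ a + c + (b + d)
  +-+-interchange = solve-∀

∑-const : ∀ n c → ∑ n (λ _ → c) ≡ n * c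
∑-const zero    c = refl
∑-const (suc n) c = cong (c +_) (∑-const n c)

∑-swap : ∀ n m (f : ℕ → ℕ → ℕ) → ∑ n (λ k → ∑ m (f k)) ≡ ∑ m (λ i → ∑ n (λ k → f k i))
∑-swap zero    m f = sym (trans (∑-const m 0) (*-zeroʳ m))
∑-swap (suc n) m f = trans (cong (∑ m (f 0) +_) (∑-swap n m (λ k → f (suc k))))
                           (sym (∑-+ m (f 0) (λ i → ∑ n (λ k → f (suc k) i))))

∑≡0⇒≡0 : ∀ n (f : ℕ → ℕ) → ∑ n f ≡ 0 → ∀ k → k < n → f k ≡ 0
∑≡0⇒≡0 (suc n) f e zero    _         = m+n≡0⇒m≡0 (f 0) e
∑≡0⇒≡0 (suc n) f e (suc k) (s≤s k<n) = ∑≡0⇒≡0 n (λ k → f (suc k)) (m+n≡0⇒n≡0 (f 0) e) k k<n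

∑<n⇒∃≡0 : ∀ n (f : ℕ → ℕ) → ∑ n f < n → ∃ λ k → f k ≡ 0
∑<n⇒∃≡0 (suc n) f ∑<n with f 0 in f0≡
... | zero  = 0 , f0≡
... | suc a with ∑<n⇒∃≡0 n (λ k → f (suc k)) (≤-trans (s≤s (m≤n+m _ a)) (≤-pred ∑<n))
...   | k , fk≡0 = suc k , fk≡0

∑-even-odd : ∀ n (f : ℕ → ℕ) → ∑ (n + n) f ≡ ∑ n (λ k → f (2 * k)) + ∑ n (λ k → f (suc (2 * k)))
∑-even-odd zero    f = refl
∑-even-odd (suc n) f = begin
    f 0 + ∑ (n + suc n) (λ k → f (suc k))
  ≡⟨ cong (λ m → f 0 + ∑ m (λ k → f (suc k))) (+-suc n n) ⟩
    f 0 + (f 1 + ∑ (n + n) (λ k → f (2 + k)))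
  ≡⟨ cong (λ t → f 0 + (f 1 + t)) (∑-even-odd n (λ k → f (2 + k))) ⟩
    f 0 + (f 1 + (∑ n (λ k → f (2 + 2 * k)) + ∑ n (λ k → f (3 + 2 * k))))
  ≡⟨ regroup (f 0) (f 1) _ _ ⟩
    (f 0 + ∑ n (λ k → f (2 + 2 * k))) + (f 1 + ∑ n (λ k → f (3 + 2 * k)))
  ≡⟨ cong₂ (λ a b → (f 0 + a) + (f 1 + b)) (∑-cong n (λ k → cong f (2+2k k)))
                                             (∑-cong n (λ k → cong (λ m → f (suc m)) (2+2k k))) ⟩
    (f 0 + ∑ n (λ k → f (2 * suc k))) + (f 1 + ∑ n (λ k → f (suc (2 * suc k))))
  ∎
  where
  open ≡-Reasoning
  regroup : ∀ a b c d → a + (b + (c + d)) ≡ (a + c) + (b + d)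
  regroup = solve-∀
  2+2k : ∀ k → 2 + 2 * k ≡ 2 * suc k
  2+2k = solve-∀

Periodic : (ℕ → ℕ) → ℕ → Set
Periodic β P = ∀ k → β (k + P) ≡ β k

periodic-multiple : ∀ {β P} → Periodic β P → ∀ c k → β (k + c * P) ≡ β k
periodic-multiple {β} p zero    k = cong β (+-identityʳ k)
periodic-multiple {β} {P} p (suc c) k =
  trans (cong β (reassoc k P (c * P))) (trans (p (k + c * P)) (periodic-multiple p c k))
  where
  reassoc : ∀ k P x → k + (P + x) ≡ k + x + P
  reassoc = solve-∀

periodic-restrict : ∀ {β} m P → Periodic β (m * P) → Periodic (λ k → β (m * k)) P
periodic-restrict {β} m P p k = trans (cong β (*-distribˡ-+ m k P)) (p (m * k))

doubled : (ℕ → ℕ) → ℕ → ℕ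
doubled β k = β (2 * k)

doubled-periodic : ∀ {β} P → Periodic β P → Periodic (doubled β) P
doubled-periodic P p = periodic-restrict 2 P (periodic-multiple p 2)

folded-periodic : ∀ {β} P → Periodic β (2 * P) → Periodic (λ y → β y + β (y + P)) P
folded-periodic {β} P p y =
  trans (cong (β (y + P) +_) (trans (cong β (y+P+P y P)) (p y))) (+-comm (β (y + P)) (β y))
  where
  y+P+P : ∀ y P → y + P + P ≡ y + 2 * P
  y+P+P = solve-∀

-- Odd residues are permuted by odd multipliers

oddSum : (ℕ → ℕ) → ℕ → ℕ
oddSum β N = ∑ N (λ k → β (suc (2 * k)))

-- Induction on h: in the
-- step β has period 2P with P = 2^(h+1), the upper half of the odd residues
-- below 2P is the lower half shifted by P, so both sides are the matching
-- sums for the folded function y ↦ β y + β (y + P), which has period P.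
oddSum-odd-multiplier : ∀ h c β → Periodic β (2 ^ suc h) →
  ∑ (2 ^ h) (λ k → β (suc (2 * c) * suc (2 * k))) ≡ oddSum β (2 ^ h)
oddSum-odd-multiplier zero c β p =
  cong (_+ 0) (trans (cong β (odd·1 c)) (periodic-multiple p c 1))
  where
  odd·1 : ∀ c → suc (2 * c) * 1 ≡ 1 + c * 2
  odd·1 = solve-∀
oddSum-odd-multiplier (suc h) c β p = begin
    ∑ (a + (a + 0)) F
  ≡⟨ cong (λ m → ∑ (a + m) F) (+-identityʳ a) ⟩
    ∑ (a + a) F
  ≡⟨ ∑-++ a a F ⟩
    ∑ a F + ∑ a (λ k → F (a + k))
  ≡⟨ cong (∑ a F +_) (∑-cong a (λ k → trans (cong β (upper-F a c k)) (periodic-multiple p c _))) ⟩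
    ∑ a F + ∑ a (λ k → β (j * suc (2 * k) + P))
  ≡⟨ sym (∑-+ a _ _) ⟩
    ∑ a (λ k → βᶠ (j * suc (2 * k)))
  ≡⟨ oddSum-odd-multiplier h c βᶠ (folded-periodic P p) ⟩
    ∑ a (λ k → βᶠ (suc (2 * k)))
  ≡⟨ ∑-+ a _ _ ⟩
    ∑ a G + ∑ a (λ k → β (suc (2 * k) + P))
  ≡⟨ cong (∑ a G +_) (∑-cong a (λ k → cong β (upper-G a k))) ⟩
    ∑ a G + ∑ a (λ k → G (a + k))
  ≡⟨ sym (∑-++ a a G) ⟩
    ∑ (a + a) G
  ≡⟨ cong (λ m → ∑ (a + m) G) (sym (+-identityʳ a)) ⟩
    ∑ (a + (a + 0)) G
  ∎
  where
  open ≡-Reasoning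
  a = 2 ^ h
  P = 2 * a
  j = suc (2 * c)
  F = λ k → β (j * suc (2 * k))
  G = λ k → β (suc (2 * k))
  βᶠ = λ y → β y + β (y + P)
  upper-F : ∀ a c k → suc (2 * c) * suc (2 * (a + k))
                    ≡ suc (2 * c) * suc (2 * k) + 2 * a + c * (2 * (2 * a))
  upper-F = solve-∀
  upper-G : ∀ a k → suc (2 * k) + 2 * a ≡ suc (2 * (a + k))
  upper-G = solve-∀

-- Decomposition of the residues by 2-adic valuation

-- lowMass ℓ s β: the sum of β over the residues of [0, 2^(ℓ+s)) whose
-- 2-adic valuation v is < ℓ, computed layer by layer (layer v consists of
-- the odd multiples of 2^v).
lowMass : ℕ → ℕ → (ℕ → ℕ) → ℕ
lowMass zero    s β = 0
lowMass (suc ℓ) s β = oddSum β (2 ^ (ℓ + s)) + lowMass ℓ s (doubled β)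

∑-by-valuation : ∀ ℓ s β → ∑ (2 ^ (ℓ + s)) β ≡ lowMass ℓ s β + ∑ (2 ^ s) (λ k → β (2 ^ ℓ * k))
∑-by-valuation zero    s β = ∑-cong (2 ^ s) (λ k → cong β (sym (+-identityʳ k)))
∑-by-valuation (suc ℓ) s β = begin
    ∑ (N + (N + 0)) β
  ≡⟨ cong (λ m → ∑ (N + m) β) (+-identityʳ N) ⟩
    ∑ (N + N) β
  ≡⟨ ∑-even-odd N β ⟩
    ∑ N (doubled β) + oddSum β N
  ≡⟨ cong (_+ oddSum β N) (∑-by-valuation ℓ s (doubled β)) ⟩
    lowMass ℓ s (doubled β) + ∑ (2 ^ s) (λ k → β (2 * (2 ^ ℓ * k))) + oddSum β N
  ≡⟨ cong (λ t → lowMass ℓ s (doubled β) + t + oddSum β N)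
          (∑-cong (2 ^ s) (λ k → cong β (sym (*-assoc 2 (2 ^ ℓ) k)))) ⟩
    lowMass ℓ s (doubled β) + R + oddSum β N
  ≡⟨ rotate (lowMass ℓ s (doubled β)) R (oddSum β N) ⟩
    oddSum β N + lowMass ℓ s (doubled β) + R
  ∎
  where
  open ≡-Reasoning
  N = 2 ^ (ℓ + s)
  R = ∑ (2 ^ s) (λ k → β (2 ^ suc ℓ * k))
  rotate : ∀ a b c → a + b + c ≡ c + a + b
  rotate = solve-∀

-- badMultiples ℓ β x = ∑_{1 ≤ j < 2^ℓ} β (j x), with j written as
-- (2i + 1)·2^v and the terms grouped by the valuation v.
badMultiples : ℕ → (ℕ → ℕ) → ℕ → ℕ
badMultiples zero    β x = 0
badMultiples (suc ℓ) β x = ∑ (2 ^ ℓ) (λ i → β (suc (2 * i) * x)) + badMultiples ℓ (doubled β) x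

parity : ∀ j → ∃ λ q → j ≡ 2 * q ⊎ j ≡ suc (2 * q)
parity zero    = 0 , inj₁ refl
parity (suc j) with parity j
... | q , inj₁ j≡2q   = q , inj₂ (cong suc j≡2q)
... | q , inj₂ j≡2q+1 = suc q , inj₁ (trans (cong suc j≡2q+1) (2+2q q))
  where
  2+2q : ∀ q → suc (suc (2 * q)) ≡ 2 * suc q
  2+2q = solve-∀

badMultiples≡0⇒ : ∀ ℓ β x → badMultiples ℓ β x ≡ 0 → ∀ j → 1 ≤ j → j < 2 ^ ℓ → β (j * x) ≡ 0
badMultiples≡0⇒ zero    β x _ zero    ()  _
badMultiples≡0⇒ zero    β x _ (suc j) _   (s≤s ())
badMultiples≡0⇒ (suc ℓ) β x none j 1≤j j< with parity j
badMultiples≡0⇒ (suc ℓ) β x none .(suc (2 * q)) _ j< | q , inj₂ refl =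
  ∑≡0⇒≡0 (2 ^ ℓ) _ (m+n≡0⇒m≡0 _ none) q (*-cancelˡ-< 2 q (2 ^ ℓ) (<-trans (n<1+n _) j<))
badMultiples≡0⇒ (suc ℓ) β x none .0 () j< | zero , inj₁ refl
badMultiples≡0⇒ (suc ℓ) β x none .(2 * suc q) _ j< | suc q , inj₁ refl =
  trans (cong β (*-assoc 2 (suc q) x))
        (badMultiples≡0⇒ ℓ (doubled β) x (m+n≡0⇒n≡0 _ none) (suc q) (s≤s z≤n)
                         (*-cancelˡ-< 2 (suc q) (2 ^ ℓ) j<))

badMultiples-periodic : ∀ ℓ β P x → Periodic β P → badMultiples ℓ β (x + P) ≡ badMultiples ℓ β x
badMultiples-periodic zero    β P x p = refl
badMultiples-periodic (suc ℓ) β P x p =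
  cong₂ _+_ (∑-cong (2 ^ ℓ) (λ i → trans (cong β (*-distribˡ-+ (suc (2 * i)) x P))
                                         (periodic-multiple p (suc (2 * i)) _)))
            (badMultiples-periodic ℓ (doubled β) P x (doubled-periodic P p))

-- Double counting over the odd residues

∑-odd-layer : ∀ h m β → Periodic β (2 ^ suc h) →
  ∑ (2 ^ h) (λ k → ∑ m (λ i → β (suc (2 * i) * suc (2 * k)))) ≡ m * oddSum β (2 ^ h)
∑-odd-layer h m β p = begin
    ∑ (2 ^ h) (λ k → ∑ m (λ i → β (suc (2 * i) * suc (2 * k))))
  ≡⟨ ∑-swap (2 ^ h) m _ ⟩
    ∑ m (λ i → ∑ (2 ^ h) (λ k → β (suc (2 * i) * suc (2 * k))))
  ≡⟨ ∑-cong m (λ i → oddSum-odd-multiplier h i β p) ⟩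
    ∑ m (λ _ → oddSum β (2 ^ h))
  ≡⟨ ∑-const m _ ⟩
    m * oddSum β (2 ^ h)
  ∎
  where open ≡-Reasoning

-- Summed over the 2^(L+s) odd residues x, the bad multiples of x count each
-- residue of valuation ≤ L exactly 2^L times.
∑-badMultiples-odd : ∀ L s β → Periodic β (2 ^ (suc L + s)) →
  ∑ (2 ^ (L + s)) (λ k → badMultiples (suc L) β (suc (2 * k))) ≡ 2 ^ L * lowMass (suc L) s β

∑-higher-layers : ∀ L s β → Periodic β (2 ^ (suc L + s)) →
  ∑ (2 ^ (L + s)) (λ k → badMultiples L (doubled β) (suc (2 * k))) ≡ 2 ^ L * lowMass L s (doubled β)

∑-badMultiples-odd L s β p = begin
    ∑ N (λ k → A k + B k)
  ≡⟨ ∑-+ N A B ⟩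
    ∑ N A + ∑ N B
  ≡⟨ cong₂ _+_ (∑-odd-layer (L + s) (2 ^ L) β p) (∑-higher-layers L s β p) ⟩
    2 ^ L * oddSum β N + 2 ^ L * lowMass L s (doubled β)
  ≡⟨ sym (*-distribˡ-+ (2 ^ L) _ _) ⟩
    2 ^ L * lowMass (suc L) s β
  ∎
  where
  open ≡-Reasoning
  N = 2 ^ (L + s)
  A = λ k → ∑ (2 ^ L) (λ i → β (suc (2 * i) * suc (2 * k)))
  B = λ k → badMultiples L (doubled β) (suc (2 * k))

∑-higher-layers zero s β p = trans (∑-const (2 ^ s) 0) (*-zeroʳ (2 ^ s))
∑-higher-layers (suc L) s β p = begin
    ∑ (N + (N + 0)) B
  ≡⟨ cong (λ m → ∑ (N + m) B) (+-identityʳ N) ⟩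
    ∑ (N + N) B
  ≡⟨ ∑-++ N N B ⟩
    ∑ N B + ∑ N (λ k → B (N + k))
  ≡⟨ cong (∑ N B +_) (∑-cong N B-periodic) ⟩
    ∑ N B + ∑ N B
  ≡⟨ cong (λ t → t + t) (∑-badMultiples-odd L s (doubled β) p₂) ⟩
    2 ^ L * D + 2 ^ L * D
  ≡⟨ twice (2 ^ L) D ⟩
    2 ^ suc L * D
  ∎
  where
  open ≡-Reasoning
  N = 2 ^ (L + s)
  D = lowMass (suc L) s (doubled β)
  B = λ k → badMultiples (suc L) (doubled β) (suc (2 * k))
  p₂ : Periodic (doubled β) (2 * N)
  p₂ = periodic-restrict 2 (2 * N) p
  shift : ∀ N k → suc (2 * (N + k)) ≡ suc (2 * k) + 2 * N
  shift = solve-∀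
  B-periodic : ∀ k → B (N + k) ≡ B k
  B-periodic k = trans (cong (badMultiples (suc L) (doubled β)) (shift N k))
                       (badMultiples-periodic (suc L) (doubled β) (2 * N) _ p₂)
  twice : ∀ x d → x * d + x * d ≡ 2 * x * d
  twice = solve-∀

Good : ℕ → (ℕ → ℕ) → Set
Good ℓ β = ∃ λ x → ∀ j → 1 ≤ j → j < 2 ^ ℓ → β (j * x) ≡ 0

good-restrict : ∀ ℓ m β → Good ℓ (λ k → β (m * k)) → Good ℓ β
good-restrict ℓ m β (x , good) = m * x , λ j 1≤j j< → trans (cong β (exchange j m x)) (good j 1≤j j<)
  where
  exchange : ∀ j m x → j * (m * x) ≡ m * (j * x)
  exchange = solve-∀

small-mass : ∀ {S M t} → t ≤ M → S * M < t → S ≡ 0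
small-mass {zero}        _   _     = refl
small-mass {suc S} {M} t≤M SM<t = ⊥-elim (<⇒≱ SM<t (≤-trans t≤M (m≤m+n M (S * M))))

good-small : ∀ ℓ n β M → 2 ^ n ≤ M → ∑ (2 ^ n) β * M < 2 ^ n → Good ℓ β
good-small ℓ n β M 2^n≤M sparse = 0 , λ j _ _ → trans (cong β (*-zeroʳ j)) β0≡0
  where
  β0≡0 : β 0 ≡ 0
  β0≡0 = ∑≡0⇒≡0 (2 ^ n) β (small-mass 2^n≤M sparse) 0 (m^n>0 2 n)

small-exponent : ∀ {n ℓ M} → suc M ≡ 2 ^ ℓ → n < ℓ → 2 ^ n ≤ M
small-exponent {n} M+1≡2^ℓ n<ℓ =
  ≤-pred (subst (2 ^ n <_) (sym M+1≡2^ℓ) (^-monoʳ-< 2 (s≤s (s≤s z≤n)) n<ℓ))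

good-odd : ∀ L s β → Periodic β (2 ^ (suc L + s)) →
  2 ^ L * lowMass (suc L) s β < 2 ^ (L + s) → Good (suc L) β
good-odd L s β p few with ∑<n⇒∃≡0 (2 ^ (L + s)) _
                            (subst (_< 2 ^ (L + s)) (sym (∑-badMultiples-odd L s β p)) few)
... | k , none = suc (2 * k) , badMultiples≡0⇒ (suc L) β (suc (2 * k)) none

sparse-remainder : ∀ {D R M t} → t ≤ D → (D + R) * M < suc M * t → R * M < t
sparse-remainder {D} {R} {M} {t} t≤D sparse = +-cancelˡ-< (M * t) (R * M) t (begin-strict
    M * t + R * M  ≤⟨ +-monoˡ-≤ (R * M) (*-monoʳ-≤ M t≤D) ⟩
    M * D + R * M  ≡⟨ distrib D R M ⟩
    (D + R) * M    <⟨ sparse ⟩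
    suc M * t      ≡⟨ +-comm t (M * t) ⟩
    M * t + t      ∎)
  where
  open ≤-Reasoning
  distrib : ∀ D R M → M * D + R * M ≡ (D + R) * M
  distrib = solve-∀

restriction-sparse : ∀ L s β M → suc M ≡ 2 ^ suc L →
  2 ^ (L + s) ≤ 2 ^ L * lowMass (suc L) s β →
  ∑ (2 ^ (suc L + s)) β * M < 2 ^ (suc L + s) →
  ∑ (2 ^ s) (λ k → β (2 ^ suc L * k)) * M < 2 ^ s
restriction-sparse L s β M M+1≡2^ℓ many sparse =
  sparse-remainder 2^s≤D (subst₂ (λ m t → m * M < t) (∑-by-valuation (suc L) s β) 2^[ℓ+s] sparse)
  where
  2^s≤D : 2 ^ s ≤ lowMass (suc L) s β
  2^s≤D = *-cancelˡ-≤ (2 ^ L) {{m^n≢0 2 L}} (subst (_≤ 2 ^ L * lowMass (suc L) s β) (^-distribˡ-+-* 2 L s) many)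
  2^[ℓ+s] : 2 ^ (suc L + s) ≡ suc M * 2 ^ s
  2^[ℓ+s] = trans (^-distribˡ-+-* 2 (suc L) s) (cong (_* 2 ^ s) (sym M+1≡2^ℓ))

good-from-sparse : ∀ L n → Acc _<_ n → ∀ β M → suc M ≡ 2 ^ suc L → Periodic β (2 ^ n) →
  ∑ (2 ^ n) β * M < 2 ^ n → Good (suc L) β
good-from-sparse L n _ β M M+1≡2^ℓ p sparse with suc L ≤? n
... | no ℓ≰n = good-small (suc L) n β M (small-exponent M+1≡2^ℓ (≰⇒> ℓ≰n)) sparse
... | yes ℓ≤n with m≤n⇒∃[o]m+o≡n ℓ≤n
good-from-sparse L .(suc L + s) (acc rec) β M M+1≡2^ℓ p sparse | yes _ | s , refl
  with 2 ^ L * lowMass (suc L) s β <? 2 ^ (L + s)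
... | yes few  = good-odd L s β p few
... | no many =
  good-restrict (suc L) (2 ^ suc L) β
    (good-from-sparse L s (rec (s≤s (m≤n+m s L))) _ M M+1≡2^ℓ p-restricted
                      (restriction-sparse L s β M M+1≡2^ℓ (≮⇒≥ many) sparse))
  where
  p-restricted : Periodic (λ k → β (2 ^ suc L * k)) (2 ^ s)
  p-restricted = periodic-restrict (2 ^ suc L) (2 ^ s) (subst (Periodic β) (^-distribˡ-+-* 2 (suc L) s) p)

mod-periodic : ∀ N .{{_ : NonZero N}} (f : ℕ → ℕ) → Periodic (λ k → f (k % N)) N
mod-periodic N f k = cong f ([m+n]%n≡m%n k N)

∑-mod : ∀ N .{{_ : NonZero N}} (f : ℕ → ℕ) → ∑ N (λ k → f (k % N)) ≡ ∑ N f
∑-mod N f = ∑-cong-< N (λ k k<N → cong f (m<n⇒m%n≡m k<N))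

outsideAt : ∀ {m} → Subset m → ℕ → ℕ
outsideAt []            _       = 0
outsideAt (_ ∷ A)       (suc k) = outsideAt A k
outsideAt (inside ∷ _)  zero    = 0
outsideAt (outside ∷ _) zero    = 1

∑-outsideAt : ∀ {m} (A : Subset m) → ∑ m (outsideAt A) + ∣ A ∣ ≡ m
∑-outsideAt []            = refl
∑-outsideAt (inside ∷ A)  = trans (+-suc _ _) (cong suc (∑-outsideAt A))
∑-outsideAt (outside ∷ A) = cong suc (∑-outsideAt A)

outsideAt≡0⇒∈ : ∀ {m} (A : Subset m) (i : Fin m) → outsideAt A (toℕ i) ≡ 0 → i ∈ A
outsideAt≡0⇒∈ (inside ∷ A)  Fin.zero    _ = here
outsideAt≡0⇒∈ (outside ∷ A) Fin.zero    ()
outsideAt≡0⇒∈ (_ ∷ A)       (Fin.suc i) e = there (outsideAt≡0⇒∈ A i e)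

toℕ-mulZ : ∀ n j x → let instance _ = m^n≢0 2 n in
  toℕ (mulZ n j (x mod 2 ^ n)) ≡ (j * x) % 2 ^ n
toℕ-mulZ n j x = begin
    toℕ (mulZ n j (x mod N))    ≡⟨ toℕ-fromℕ< _ ⟩
    (j * toℕ (x mod N)) % N     ≡⟨ cong (λ y → (j * y) % N) (toℕ-fromℕ< _) ⟩
    (j * (x % N)) % N           ≡⟨ %-distribˡ-* j (x % N) N ⟩
    (j % N * (x % N % N)) % N   ≡⟨ cong (λ y → (j % N * y) % N) (m%n%n≡m%n x N) ⟩
    (j % N * (x % N)) % N       ≡⟨ sym (%-distribˡ-* j x N) ⟩
    (j * x) % N                 ∎
  where
  open ≡-Reasoning
  N = 2 ^ n
  instance _ = m^n≢0 2 n

complement-sparse : ∀ {m B a N} → 2 ≤ m → B + a ≡ N → (m ∸ 2) * N < a * (m ∸ 1) → B * (m ∸ 1) < N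
complement-sparse {suc (suc M)} {B} {a} (s≤s (s≤s _)) refl dense =
  +-cancelʳ-< (M * (B + a)) (B * suc M) (B + a) (begin-strict
    B * suc M + M * (B + a)  <⟨ +-monoʳ-< (B * suc M) dense ⟩
    B * suc M + a * suc M    ≡⟨ expand B a M ⟩
    B + a + M * (B + a)      ∎)
  where
  open ≤-Reasoning
  expand : ∀ B a M → B * suc M + a * suc M ≡ B + a + M * (B + a)
  expand = solve-∀

-- Apply the descent to the complement indicator of A; its sparseness is the
-- density hypothesis.
claim2p2 : (ℓ n : ℕ) → .{{NonZero ℓ}} → .{{NonZero n}} → 2 ^ ℓ ≤ n →
    (A : Subset (2 ^ n)) →
    (2 ^ ℓ ∸ 2) * 2 ^ n < ∣ A ∣ * (2 ^ ℓ ∸ 1) →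
    ∃ λ (x : Fin (2 ^ n)) → (j : ℕ) → 1 ≤ j → j ≤ 2 ^ ℓ ∸ 1 → mulZ n j x ∈ A
claim2p2 (suc L) n _ A dense = multiples-in-A (good-from-sparse L n (<-wellFounded n) β M M+1≡2^ℓ p sparse)
  where
  instance _ = m^n≢0 2 n
  β : ℕ → ℕ
  β k = outsideAt A (k % 2 ^ n)
  p : Periodic β (2 ^ n)
  p = mod-periodic (2 ^ n) (outsideAt A)
  M = 2 ^ suc L ∸ 1
  M+1≡2^ℓ : suc M ≡ 2 ^ suc L
  M+1≡2^ℓ = m+[n∸m]≡n (m^n>0 2 (suc L))
  complement+A : ∑ (2 ^ n) β + ∣ A ∣ ≡ 2 ^ n
  complement+A = trans (cong (_+ ∣ A ∣) (∑-mod (2 ^ n) (outsideAt A))) (∑-outsideAt A)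
  sparse : ∑ (2 ^ n) β * M < 2 ^ n
  sparse = complement-sparse {2 ^ suc L} {∑ (2 ^ n) β} {∣ A ∣} (*-monoʳ-≤ 2 (m^n>0 2 L)) complement+A dense
  multiples-in-A : Good (suc L) β → ∃ λ (x : Fin (2 ^ n)) → (j : ℕ) → 1 ≤ j → j ≤ M → mulZ n j x ∈ A
  multiples-in-A (x , good) = x mod 2 ^ n , λ j 1≤j j≤M →
    outsideAt≡0⇒∈ A _ (trans (cong (outsideAt A) (toℕ-mulZ n j x))
                             (good j 1≤j (subst (j <_) M+1≡2^ℓ (s≤s j≤M))))
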